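{- Let $T$ be a pre-Galois word, $p_o=\mathrm{Per}_o(T)$ and $p_e=\mathrm{Per}_e(T)$. Let $z$ be a symbol and $T'=T\cdot z$, and suppose that $T'[1..|T|-p_o+1]\succ_{\mathrm{alt}}T'[p_o+1..|T|+1]$ or $T'[1..|T|-p_e+1]\succ_{\mathrm{alt}}T'[p_e+1..|T|+1]$. Then $T'$ is not pre-Galois.
   Context: $W[i..j]$ is the factor from position $i$ to $j$ (1-indexed), and is $\varepsilon$ if $i>j$. An integer $p\in[1..|W|]$ is a period of $W$ if $W[i+p]=W[i]$ for all $i\in[1..|W|-p]$. $\mathrm{Per}_o(W)$ (resp. $\mathrm{Per}_e(W)$) is the shortest odd (resp. even) period of $W$, set to $|W|+1$ if none exists. Alternating order: for words $S,T$ with $S^\omega\neq T^\omega$ ($X^\omega$ the infinite repetition of $X$), let $j$ be the first position with $S^\omega[j]\neq T^\omega[j]$; $S\prec_{\mathrm{alt}}T$ if $j$ is odd and $S^\omega[j]<T^\omega[j]$, or $j$ is even and $S^\omega[j]>T^\omega[j]$. $S=_{\mathrm{alt}}T$ if $S^\omega=T^\omega$; $\varepsilon\succ_{\mathrm{alt}}X$ for every nonempty $X$. A word $T$ is pre-Galois if every proper suffix $S$ of $T$ is a prefix of $T$ or satisfies $S\succ_{\mathrm{alt}}T$. -}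

module Defs where

open import Level using (Level)
open import Data.Nat using (ℕ; zero; suc; _+_; _∸_; _≤_; _<_; _%_)
open import Data.List using (List; []; _∷_; length; take; drop; _++_; [_])
open import Data.Maybe using (Maybe; just; nothing)
open import Data.Product using (Σ; ∃; _×_; _,_)
open import Data.Sum using (_⊎_)
open import Data.Empty using (⊥)
open import Data.Unit using (⊤)
open import Relation.Nullary using (¬_)
open import Relation.Binary using (Rel; IsStrictTotalOrder)
open import Relation.Binary.PropositionalEquality using (_≡_)

module Alt {a ℓ} {A : Set a} {_⊏_ : Rel A ℓ}
           (sto : IsStrictTotalOrder _≡_ _⊏_) where

  Word : Set a
  Word = List A

  _!_ : Word → ℕ → Maybe A
  [] ! _ = nothing
  (x ∷ xs) ! zero = just x
  (x ∷ xs) ! suc n = xs ! n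

  -- 1-indexed lookup W[i]
  at : Word → ℕ → Maybe A
  at W i = W ! (i ∸ 1)

  -- 1-indexed factor W[i..j] (ε if i > j); intended for i ≥ 1
  fac : Word → ℕ → ℕ → Word
  fac W i j = take (suc j ∸ i) (drop (i ∸ 1) W)

  IsPeriod : Word → ℕ → Set a
  IsPeriod W p = 1 ≤ p × p ≤ length W ×
    (∀ i → 1 ≤ i → i ≤ length W ∸ p → at W (i + p) ≡ at W i)

  Odd Even : ℕ → Set
  Odd n = n % 2 ≡ 1
  Even n = n % 2 ≡ 0

  IsPerO : Word → ℕ → Set a
  IsPerO W q =
    (IsPeriod W q × Odd q × (∀ p → IsPeriod W p → Odd p → q ≤ p))
    ⊎ ((∀ p → IsPeriod W p → ¬ Odd p) × q ≡ suc (length W))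

  IsPerE : Word → ℕ → Set a
  IsPerE W q =
    (IsPeriod W q × Even q × (∀ p → IsPeriod W p → Even p → q ≤ p))
    ⊎ ((∀ p → IsPeriod W p → ¬ Even p) × q ≡ suc (length W))

  -- X^ω[j+1] (0-indexed j) for nonempty X = x ∷ xs
  nth : A → Word → ℕ → A
  nth d [] _ = d
  nth d (y ∷ ys) zero = y
  nth d (y ∷ ys) (suc n) = nth d ys n

  ω : A → Word → ℕ → A
  ω x xs j = nth x (x ∷ xs) (j % suc (length xs))

  _≺alt_ : Word → Word → Set (a Level.⊔ ℓ)
  [] ≺alt _ = Level.Lift _ ⊥
  (x ∷ xs) ≺alt [] = Level.Lift _ ⊤
  (x ∷ xs) ≺alt (y ∷ ys) =
    ∃ λ j → (∀ i → i < j → ω x xs i ≡ ω y ys i) ×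
      -- 0-indexed j even  ⇔  1-indexed position j+1 odd
      ((Even j × ω x xs j ⊏ ω y ys j) ⊎ (Odd j × ω y ys j ⊏ ω x xs j))

  _≻alt_ : Word → Word → Set (a Level.⊔ ℓ)
  S ≻alt T = T ≺alt S

  IsPrefix : Word → Word → Set a
  IsPrefix S T = ∃ λ U → S ++ U ≡ T

  PreGalois : Word → Set (a Level.⊔ ℓ)
  PreGalois T = ∀ k → 1 ≤ k → k ≤ length T →
    IsPrefix (drop k T) T ⊎ (drop k T ≻alt T)

{-# OPTIONS --safe #-}
-- Let p be p_o or p_e and T′ = T z, so 1 ≤ p ≤ |T′|. For p = |T′| the suffix
-- T′[p+1..] is empty, and ε is alt-greater than every word. Otherwise
-- S = T′[p+1..] is a proper suffix with S ≺alt P, where P is the prefix of T′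
-- of length |S|. Because |S| = |P|, the first disagreement of S^ω and P^ω lies
-- within the first |P| positions, where P^ω and T′^ω agree; hence S ≺alt T′.
-- So S is neither a prefix of T′ (it would equal P) nor alt-greater than T′.
module Submission where

open import Defs
open import Level using (lower)
open import Data.Nat using (ℕ; zero; suc; _+_; _∸_; _≤_; _<_; _%_; z≤n; s≤s; _<?_)
open import Data.Nat.Properties
open import Data.Nat.DivMod using (m<n⇒m%n≡m; m%n%n≡m%n; m%n<n)
open import Data.List using (List; []; _∷_; length; _++_; [_]; take; drop)
open import Data.List.Properties
  using (length-take; length-drop; take-all; take++drop≡id; length-++)
open import Data.Product using (_×_; _,_)
open import Data.Sum using (_⊎_; inj₁; inj₂)
open import Data.Empty using (⊥-elim)
open import Relation.Nullary using (¬_; yes; no)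
open import Relation.Binary using (Rel; IsStrictTotalOrder; tri<; tri≈; tri>)
open import Relation.Binary.PropositionalEquality hiding ([_])

module _ {a ℓ} {A : Set a} {_⊏_ : Rel A ℓ} (sto : IsStrictTotalOrder _≡_ _⊏_) where
  open Alt sto
  open IsStrictTotalOrder sto using (irrefl; asym)

  _≺[_]_ : A → ℕ → A → Set ℓ
  u ≺[ j ] v = (Even j × u ⊏ v) ⊎ (Odd j × v ⊏ u)

  ≺[]⇒≢ : ∀ {u v j} → u ≺[ j ] v → u ≢ v
  ≺[]⇒≢ (inj₁ (_ , u⊏v)) refl = irrefl refl u⊏v
  ≺[]⇒≢ (inj₂ (_ , v⊏u)) refl = irrefl refl v⊏u

  ≺[]-asym : ∀ {u v j} → u ≺[ j ] v → ¬ v ≺[ j ] u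
  ≺[]-asym (inj₁ (_ , u⊏v)) (inj₁ (_ , v⊏u)) = asym u⊏v v⊏u
  ≺[]-asym (inj₂ (_ , v⊏u)) (inj₂ (_ , u⊏v)) = asym v⊏u u⊏v
  ≺[]-asym (inj₁ (even , _)) (inj₂ (odd , _)) with trans (sym even) odd
  ... | ()
  ≺[]-asym (inj₂ (odd , _)) (inj₁ (even , _)) with trans (sym even) odd
  ... | ()

  ≺alt-irrefl : ∀ X → ¬ X ≺alt X
  ≺alt-irrefl (x ∷ xs) (j , _ , x≺x) = ≺[]⇒≢ {j = j} x≺x refl

  ≺alt-asym : ∀ X Y → X ≺alt Y → ¬ Y ≺alt X
  ≺alt-asym (x ∷ xs) (y ∷ ys) (j , agree , x≺y) (k , agree′ , y≺x) with <-cmp j k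
  ... | tri< j<k _ _ = ≺[]⇒≢ {j = j} x≺y (sym (agree′ j j<k))
  ... | tri≈ _ refl _ = ≺[]-asym {j = j} x≺y y≺x
  ... | tri> _ _ k<j = ≺[]⇒≢ {j = k} y≺x (sym (agree k k<j))

  ω-periodic : ∀ x xs i → ω x xs (i % suc (length xs)) ≡ ω x xs i
  ω-periodic x xs i = cong (nth x (x ∷ xs)) (m%n%n≡m%n i (suc (length xs)))

  ω-agree-on-period : ∀ x xs y ys → length xs ≡ length ys →
    (∀ i → i < suc (length xs) → ω x xs i ≡ ω y ys i) → ∀ j → ω x xs j ≡ ω y ys j
  ω-agree-on-period x xs y ys |xs|≡|ys| agree j = begin
    ω x xs j                        ≡⟨ ω-periodic x xs j ⟨
    ω x xs (j % suc (length xs))    ≡⟨ agree (j % suc (length xs)) (m%n<n j _) ⟩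
    ω y ys (j % suc (length xs))    ≡⟨ cong (λ n → ω y ys (j % suc n)) |xs|≡|ys| ⟩
    ω y ys (j % suc (length ys))    ≡⟨ ω-periodic y ys j ⟩
    ω y ys j                        ∎
    where open ≡-Reasoning

  nth-++ˡ : ∀ d (xs ys : List A) i → i < length xs → nth d (xs ++ ys) i ≡ nth d xs i
  nth-++ˡ d (x ∷ xs) ys zero    _         = refl
  nth-++ˡ d (x ∷ xs) ys (suc i) (s≤s i<n) = nth-++ˡ d xs ys i i<n

  ω-++ˡ : ∀ x xs ys i → i < suc (length xs) → ω x (xs ++ ys) i ≡ ω x xs i
  ω-++ˡ x xs ys i i<n = begin
    nth x (x ∷ xs ++ ys) (i % suc (length (xs ++ ys)))  ≡⟨ cong (nth x (x ∷ xs ++ ys)) (m<n⇒m%n≡m i<n′) ⟩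
    nth x (x ∷ xs ++ ys) i                              ≡⟨ nth-++ˡ x (x ∷ xs) ys i i<n ⟩
    nth x (x ∷ xs) i                                    ≡⟨ cong (nth x (x ∷ xs)) (m<n⇒m%n≡m i<n) ⟨
    nth x (x ∷ xs) (i % suc (length xs))                ∎
    where
    open ≡-Reasoning
    i<n′ : i < suc (length (xs ++ ys))
    i<n′ = <-≤-trans i<n (s≤s (≤-trans (m≤m+n _ _) (≤-reflexive (sym (length-++ xs)))))

  ≺alt-++ʳ : ∀ S P U → length S ≡ length P → S ≺alt P → S ≺alt (P ++ U)
  ≺alt-++ʳ (s ∷ ss) (q ∷ qs) U |S|≡|P| (j , agree , s≺q) with j <? suc (length ss)
  ... | yes j<n = j , agree′ , subst (ω s ss j ≺[ j ]_) (sym (ω-++ˡ q qs U j j<n′)) s≺q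
    where
    j<n′ : j < suc (length qs)
    j<n′ = subst (j <_) |S|≡|P| j<n
    agree′ : ∀ i → i < j → ω s ss i ≡ ω q (qs ++ U) i
    agree′ i i<j = trans (agree i i<j) (sym (ω-++ˡ q qs U i (<-trans i<j j<n′)))
  ... | no j≮n = ⊥-elim (≺[]⇒≢ {j = j} s≺q
    (ω-agree-on-period s ss q qs (suc-injective |S|≡|P|)
      (λ i i<n → agree i (<-≤-trans i<n (≮⇒≥ j≮n))) j))

  take-length-++ : ∀ (S U : List A) → take (length S) (S ++ U) ≡ S
  take-length-++ []       U = refl
  take-length-++ (s ∷ ss) U = cong (s ∷_) (take-length-++ ss U)

  drop≺alt-take⇒drop≺alt : ∀ W k → drop k W ≺alt take (length W ∸ k) W → drop k W ≺alt W
  drop≺alt-take⇒drop≺alt W k S≺P =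
    subst (S ≺alt_) (take++drop≡id m W) (≺alt-++ʳ S P (drop m W) |S|≡|P| S≺P)
    where
    S = drop k W
    m = length W ∸ k
    P = take m W
    |S|≡|P| : length S ≡ length P
    |S|≡|P| = trans (length-drop k W)
      (sym (trans (length-take m W) (m≤n⇒m⊓n≡m (m∸n≤m (length W) k))))

  suffix≺alt-prefix⇒¬PreGalois : ∀ W k → 1 ≤ k → k ≤ length W →
    drop k W ≺alt take (length W ∸ k) W → ¬ PreGalois W
  suffix≺alt-prefix⇒¬PreGalois W k 1≤k k≤|W| S≺P preGalois
    with preGalois k 1≤k k≤|W|
  ... | inj₂ W≺S = ≺alt-asym (drop k W) W (drop≺alt-take⇒drop≺alt W k S≺P) W≺S
  ... | inj₁ (U , S++U≡W) = ≺alt-irrefl P (subst (_≺alt P) S≡P S≺P)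
    where
    S = drop k W
    P = take (length W ∸ k) W
    S≡P : S ≡ P
    S≡P = begin
      S                            ≡⟨ take-length-++ S U ⟨
      take (length S) (S ++ U)     ≡⟨ cong₂ take (length-drop k W) S++U≡W ⟩
      P                            ∎
      where open ≡-Reasoning

  fac-empty : ∀ W {i j} → j < i → fac W i j ≡ []
  fac-empty W j<i rewrite m≤n⇒m∸n≡0 j<i = refl

  fac-suffix : ∀ W p → fac W (p + 1) (length W) ≡ drop p W
  fac-suffix W p rewrite m+n∸n≡m p 1 = take-all _ (drop p W)
    (≤-reflexive (trans (length-drop p W) (cong (suc (length W) ∸_) (+-comm 1 p))))

  shifted-suffix≺alt-prefix⇒¬PreGalois : ∀ T z p → 1 ≤ p → p ≤ suc (length T) →
    fac (T ++ [ z ]) (p + 1) (length T + 1) ≺alt fac (T ++ [ z ]) 1 (length T ∸ p + 1) →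
    ¬ PreGalois (T ++ [ z ])
  shifted-suffix≺alt-prefix⇒¬PreGalois T z p 1≤p p≤1+n S≺P
    with m≤n⇒m<n∨m≡n p≤1+n
  ... | inj₂ refl = λ _ → lower (subst (_≺alt fac (T ++ [ z ]) 1 (length T ∸ p + 1))
    (fac-empty (T ++ [ z ]) (n<1+n (length T + 1))) S≺P)
  ... | inj₁ (s≤s p≤n) = suffix≺alt-prefix⇒¬PreGalois T′ p 1≤p
    (≤-trans p≤n (≤-trans (m≤m+n _ 1) (≤-reflexive (sym |T′|≡n+1))))
    (subst₂ _≺alt_ suffix≡ prefix≡ S≺P)
    where
    T′ = T ++ [ z ]
    |T′|≡n+1 : length T′ ≡ length T + 1
    |T′|≡n+1 = length-++ T
    suffix≡ : fac T′ (p + 1) (length T + 1) ≡ drop p T′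
    suffix≡ = trans (cong (fac T′ (p + 1)) (sym |T′|≡n+1)) (fac-suffix T′ p)
    prefix≡ : take (length T ∸ p + 1) T′ ≡ take (length T′ ∸ p) T′
    prefix≡ = cong (λ m → take m T′)
      (sym (trans (cong (_∸ p) |T′|≡n+1) (+-∸-comm 1 p≤n)))

  Per-bounds : ∀ {b c} {X : Set b} {Y : Set c} W {q} →
    (IsPeriod W q × X) ⊎ (Y × q ≡ suc (length W)) → 1 ≤ q × q ≤ suc (length W)
  Per-bounds W (inj₁ ((1≤q , q≤|W| , _) , _)) = 1≤q , m≤n⇒m≤1+n q≤|W|
  Per-bounds W (inj₂ (_ , refl))              = s≤s z≤n , ≤-refl

lemma19 : ∀ {a ℓ} {A : Set a} {_<_ : Rel A ℓ} (sto : IsStrictTotalOrder _≡_ _<_) →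
    let open Alt sto in
    (T : List A) (po pe : ℕ) (z : A) →
    PreGalois T → IsPerO T po → IsPerE T pe →
    let T′ = T ++ [ z ] in
    (fac T′ 1 (length T ∸ po + 1) ≻alt fac T′ (po + 1) (length T + 1))
      ⊎ (fac T′ 1 (length T ∸ pe + 1) ≻alt fac T′ (pe + 1) (length T + 1)) →
    ¬ PreGalois T′
lemma19 sto T po pe z _ isPerO isPerE (inj₁ po-shift) =
  let (1≤po , po≤1+n) = Per-bounds sto T isPerO in
  shifted-suffix≺alt-prefix⇒¬PreGalois sto T z po 1≤po po≤1+n po-shift
lemma19 sto T po pe z _ isPerO isPerE (inj₂ pe-shift) =
  let (1≤pe , pe≤1+n) = Per-bounds sto T isPerE in
  shifted-suffix≺alt-prefix⇒¬PreGalois sto T z pe 1≤pe pe≤1+n pe-shift
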